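{- Let $r\ge 0$ be an integer, let $\lambda$ be a subgraph of $\Gamma$, and let $\phi:B_r\to\lambda$ be a graph isomorphism. Then $\lambda=B_r+\phi(0)$.
   Context: Let $G$ be a free abelian group of finite rank $k\ge1$, identified with $\mathbb{Z}^k$, and $\mathcal{A}\subset G$ a finite generating set with $\mathcal{A}=-\mathcal{A}$, $0\notin\mathcal{A}$. $\Gamma=\mathrm{Cay}(G,\mathcal{A})$ has vertex set $G$ and edges $\{x,x+a\}$, $a\in\mathcal{A}$. $\rho(x)$ is the length of a shortest path in $\Gamma$ from $0$ to $x$. $B_r$ is the subgraph of $\Gamma$ induced by $\{x:\rho(x)\le r\}$. For a subgraph $\mu$ of $\Gamma$ and $x\in G$, $\mu+x$ is the subgraph obtained by translating all vertices and edges by $x$. -}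

module Defs where

open import Data.Nat using (ℕ; zero; suc; _≤_)
open import Data.Integer as ℤ using (ℤ; +_)
open import Data.Vec using (Vec; zipWith; replicate; map)
open import Data.List using (List; []; _∷_)
open import Data.List.Membership.Propositional using (_∈_)
open import Data.List.Relation.Unary.All using (All)
open import Data.Product using (Σ; ∃; ∃-syntax; _×_; _,_)
open import Data.Sum using (_⊎_; inj₁; inj₂; swap)
open import Relation.Nullary using (¬_)
open import Relation.Binary.PropositionalEquality using (_≡_)
open import Function.Bundles using (_⇔_)

G : ℕ → Set
G k = Vec ℤ k

infixl 6 _⊕_
_⊕_ : ∀ {k} → G k → G k → G k
_⊕_ = zipWith ℤ._+_

𝟎 : ∀ {k} → G k
𝟎 {k} = replicate k (+ 0)

neg : ∀ {k} → G k → G k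
neg = map (λ z → ℤ.- z)

sumG : ∀ {k} → List (G k) → G k
sumG []       = 𝟎
sumG (x ∷ xs) = x ⊕ sumG xs

-- A finite generating set 𝒜 (given as a list), symmetric, not containing 0.
-- Since 𝒜 = -𝒜, "generates G as a group" = every element is a finite sum of elements of 𝒜.
record GenSet (k : ℕ) : Set where
  field
    elems     : List (G k)
    symmetric : ∀ {a} → a ∈ elems → neg a ∈ elems
    no-zero   : ¬ (𝟎 ∈ elems)
    generates : ∀ (x : G k) → Σ (List (G k)) λ w → All (_∈ elems) w × sumG w ≡ x

module Cayley {k : ℕ} (𝒜 : GenSet k) where
  open GenSet 𝒜

  Adj : G k → G k → Set
  Adj x y = Σ (G k) λ a → a ∈ elems × y ≡ x ⊕ a

  data Walk : G k → G k → ℕ → Set where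
    here : ∀ {x} → Walk x x zero
    step : ∀ {x y z n} → Adj x y → Walk y z n → Walk x z (suc n)

  ρ≤ : G k → ℕ → Set
  ρ≤ x r = Σ ℕ λ n → n ≤ r × Walk 𝟎 x n

  Edge : G k → G k → Set
  Edge x y = Adj x y ⊎ Adj y x

  record Subgraph : Set₁ where
    field
      V     : G k → Set
      E     : G k → G k → Set
      E-sym : ∀ {x y} → E x y → E y x
      E-ok  : ∀ {x y} → E x y → V x × V y × Edge x y
  open Subgraph public

  B : ℕ → Subgraph
  B r = record
    { V = λ x → ρ≤ x r
    ; E = λ x y → ρ≤ x r × ρ≤ y r × Edge x y
    ; E-sym = λ { (p , q , e) → q , p , swap e }
    ; E-ok = λ e → e
    }

  TransV : Subgraph → G k → G k → Set
  TransV μ t x = Σ (G k) λ z → V μ z × x ≡ z ⊕ t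

  TransE : Subgraph → G k → G k → G k → Set
  TransE μ t x y = Σ (G k) λ z → Σ (G k) λ w → E μ z w × x ≡ z ⊕ t × y ≡ w ⊕ t

  _≐_+_ : Subgraph → Subgraph → G k → Set
  ν ≐ μ + t = (∀ x → V ν x ⇔ TransV μ t x) × (∀ x y → E ν x y ⇔ TransE μ t x y)

  -- φ : μ → ν is a graph isomorphism (φ given on all of G; only its
  -- restriction to the vertices of μ matters)
  record IsIso (μ ν : Subgraph) (φ : G k → G k) : Set where
    field
      maps-to  : ∀ {x} → V μ x → V ν (φ x)
      injective : ∀ {x y} → V μ x → V μ y → φ x ≡ φ y → x ≡ y
      surjective : ∀ {y} → V ν y → Σ (G k) λ x → V μ x × φ x ≡ y
      edges    : ∀ {x y} → V μ x → V μ y → E μ x y ⇔ E ν (φ x) (φ y)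

module Submission where

-- Put c = φ(0) and ψ(x) = φ(x) - c.  Since λ′ is a subgraph of Γ, φ carries every
-- edge of B_r to an edge of Γ, hence every walk of length n ≤ r from 0 (which never
-- leaves B_r) to a walk of length n from c.  Translating by -c, ψ maps B_r into B_r,
-- injectively, and maps edges of B_r injectively to edges of B_r.  Vertex and edge
-- sets of B_r are finite, and an injective self-map of a finite set is surjective;
-- so ψ is a bijection of B_r onto itself and of its edge set onto itself.  Undoing the
-- translation, the vertices and edges of λ′ are exactly those of B_r + c.

open import Data.Nat using (ℕ; zero; suc; _≤_; _≥_; _+_; s≤s; s≤s⁻¹)
open import Data.Nat.Properties using (≤-trans; m≤m+n; +-suc)
import Data.Integer as ℤ
import Data.Integer.Properties as ℤP
import Data.Vec.Properties as VecP
open import Data.List using (List; []; _∷_; map; concatMap; upTo; filter; cartesianProduct)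
open import Data.List.Membership.Propositional using (_∈_; find; lose)
open import Data.List.Membership.Propositional.Properties
  using (∈-map⁺; ∈-map⁻; ∈-concatMap⁺; ∈-concatMap⁻; ∈-upTo⁺; ∈-upTo⁻;
         ∈-filter⁺; ∈-filter⁻; ∈-cartesianProduct⁺; ∈-cartesianProduct⁻; finite)
import Data.List.Membership.DecPropositional as DecMembership
open import Data.List.Relation.Unary.Any using (here; any?)
open import Data.Product using (∃; _×_; _,_; proj₁; proj₂)
open import Data.Product.Properties using (≡-dec)
open import Data.Sum using (inj₁; inj₂)
open import Data.Empty using (⊥-elim)
open import Relation.Nullary using (¬_; yes; no; Dec)
open import Relation.Nullary.Decidable using (map′; _⊎-dec_)
open import Relation.Binary.Definitions using (DecidableEquality)
open import Relation.Binary.PropositionalEquality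
  using (_≡_; refl; sym; trans; cong; cong₂; subst; subst₂; module ≡-Reasoning)
open import Function.Bundles using (_⇔_; mk⇔; mk↣; Equivalence)
open import Defs

record Enumeration {A : Set} (P : A → Set) : Set where
  field
    list     : List A
    complete : ∀ {x} → P x → x ∈ list
    sound    : ∀ {x} → x ∈ list → P x
open Enumeration

enumerate-related-pairs : ∀ {A B : Set} {P : A → Set} {Q : B → Set} {R : A → B → Set} →
  Enumeration P → Enumeration Q → (∀ x y → Dec (R x y)) →
  Enumeration (λ p → P (proj₁ p) × Q (proj₂ p) × R (proj₁ p) (proj₂ p))
enumerate-related-pairs {A} {B} {P} {Q} {R} eP eQ R? = record
  { list     = filter R?′ (cartesianProduct (list eP) (list eQ))
  ; complete = λ (Px , Qy , Rxy) →
      ∈-filter⁺ R?′ (∈-cartesianProduct⁺ (complete eP Px) (complete eQ Qy)) Rxy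
  ; sound    = sound′
  }
  where
  R?′ : (p : A × B) → Dec (R (proj₁ p) (proj₂ p))
  R?′ (x , y) = R? x y
  sound′ : ∀ {p} → p ∈ filter R?′ (cartesianProduct (list eP) (list eQ)) →
           P (proj₁ p) × Q (proj₂ p) × R (proj₁ p) (proj₂ p)
  sound′ {x , y} p∈ with p∈pairs , Rxy ← ∈-filter⁻ R?′ {xs = cartesianProduct (list eP) (list eQ)} p∈
                      with x∈ , y∈ ← ∈-cartesianProduct⁻ (list eP) (list eQ) p∈pairs
                      = sound eP x∈ , sound eQ y∈ , Rxy

-- If y ∈ P had no preimage, its orbit y, f y, f² y, … would be an injective sequence
-- inside the finite list enumerating P, which `finite` rules out.
module _ {A : Set} (_≟_ : DecidableEquality A) {P : A → Set} (enum : Enumeration P)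
         (f : A → A) (f-maps : ∀ {x} → P x → P (f x))
         (f-injective : ∀ {x y} → P x → P y → f x ≡ f y → x ≡ y) where
  open DecMembership _≟_ using (_∈?_)

  injective⇒surjective : ∀ {y} → P y → ∃ λ x → P x × f x ≡ y
  injective⇒surjective {y} Py with y ∈? map f (list enum)
  ... | yes y∈image with x , x∈ , y≡fx ← ∈-map⁻ f y∈image = x , sound enum x∈ , sym y≡fx
  ... | no y∉image = ⊥-elim (finite (mk↣ orbit-injective) (list enum) (λ n → complete enum (orbit-P n)))
    where
    orbit : ℕ → A
    orbit zero    = y
    orbit (suc n) = f (orbit n)

    orbit-P : ∀ n → P (orbit n)
    orbit-P zero    = Py
    orbit-P (suc n) = f-maps (orbit-P n)

    no-preimage : ∀ n → ¬ (y ≡ f (orbit n))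
    no-preimage n y≡ = y∉image (subst (_∈ map f (list enum)) (sym y≡) (∈-map⁺ f (complete enum (orbit-P n))))

    orbit-injective : ∀ {m n} → orbit m ≡ orbit n → m ≡ n
    orbit-injective {zero}  {zero}  _ = refl
    orbit-injective {zero}  {suc n} e = ⊥-elim (no-preimage n e)
    orbit-injective {suc m} {zero}  e = ⊥-elim (no-preimage m (sym e))
    orbit-injective {suc m} {suc n} e = cong suc (orbit-injective (f-injective (orbit-P m) (orbit-P n) e))

module _ {k : ℕ} where
  ⊕-assoc : ∀ (x y z : G k) → (x ⊕ y) ⊕ z ≡ x ⊕ (y ⊕ z)
  ⊕-assoc = VecP.zipWith-assoc ℤP.+-assoc

  ⊕-comm : ∀ (x y : G k) → x ⊕ y ≡ y ⊕ x
  ⊕-comm = VecP.zipWith-comm ℤP.+-comm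

  ⊕-identityʳ : ∀ (x : G k) → x ⊕ 𝟎 ≡ x
  ⊕-identityʳ = VecP.zipWith-identityʳ ℤP.+-identityʳ

  ⊕-inverseʳ : ∀ (x : G k) → x ⊕ neg x ≡ 𝟎
  ⊕-inverseʳ = VecP.zipWith-inverseʳ ℤP.+-inverseʳ

  ⊕-inverseˡ : ∀ (x : G k) → neg x ⊕ x ≡ 𝟎
  ⊕-inverseˡ x = trans (⊕-comm (neg x) x) (⊕-inverseʳ x)

  ⊕-cancel : ∀ {a b : G k} → a ⊕ b ≡ 𝟎 → ∀ y → (y ⊕ a) ⊕ b ≡ y
  ⊕-cancel {a} {b} a+b≡0 y = begin
    (y ⊕ a) ⊕ b  ≡⟨ ⊕-assoc y a b ⟩
    y ⊕ (a ⊕ b)  ≡⟨ cong (y ⊕_) a+b≡0 ⟩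
    y ⊕ 𝟎        ≡⟨ ⊕-identityʳ y ⟩
    y            ∎
    where open ≡-Reasoning

  ⊕-swap : ∀ (x a t : G k) → (x ⊕ a) ⊕ t ≡ (x ⊕ t) ⊕ a
  ⊕-swap x a t = begin
    (x ⊕ a) ⊕ t  ≡⟨ ⊕-assoc x a t ⟩
    x ⊕ (a ⊕ t)  ≡⟨ cong (x ⊕_) (⊕-comm a t) ⟩
    x ⊕ (t ⊕ a)  ≡⟨ sym (⊕-assoc x t a) ⟩
    (x ⊕ t) ⊕ a  ∎
    where open ≡-Reasoning

  _≟G_ : DecidableEquality (G k)
  _≟G_ = VecP.≡-dec ℤ._≟_

module CayleyFacts {k : ℕ} (𝒜 : GenSet k) where
  open GenSet 𝒜
  open Cayley 𝒜

  Adj-translate : ∀ {x y} t → Adj x y → Adj (x ⊕ t) (y ⊕ t)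
  Adj-translate {x} t (a , a∈𝒜 , refl) = a , a∈𝒜 , ⊕-swap x a t

  Edge-translate : ∀ {x y} t → Edge x y → Edge (x ⊕ t) (y ⊕ t)
  Edge-translate t (inj₁ x~y) = inj₁ (Adj-translate t x~y)
  Edge-translate t (inj₂ y~x) = inj₂ (Adj-translate t y~x)

  Edge-untranslate : ∀ {x y} t → Edge (x ⊕ t) (y ⊕ t) → Edge x y
  Edge-untranslate {x} {y} t e =
    subst₂ Edge (⊕-cancel (⊕-inverseʳ t) x) (⊕-cancel (⊕-inverseʳ t) y) (Edge-translate (neg t) e)

  Walk-translate : ∀ {x y n} t → Walk x y n → Walk (x ⊕ t) (y ⊕ t) n
  Walk-translate t here           = here
  Walk-translate t (step x~y rest) = step (Adj-translate t x~y) (Walk-translate t rest)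

  Adj-sym : ∀ {x y} → Adj x y → Adj y x
  Adj-sym {x} (a , a∈𝒜 , refl) = neg a , symmetric a∈𝒜 , sym (⊕-cancel (⊕-inverseʳ a) x)

  Edge→Adj : ∀ {x y} → Edge x y → Adj x y
  Edge→Adj (inj₁ x~y) = x~y
  Edge→Adj (inj₂ y~x) = Adj-sym y~x

  snoc : ∀ {x y z n} → Walk x y n → Adj y z → Walk x z (suc n)
  snoc here           y~z = step y~z here
  snoc (step x~w rest) y~z = step x~w (snoc rest y~z)

  Adj? : ∀ x y → Dec (Adj x y)
  Adj? x y = map′ find (λ (a , a∈𝒜 , y≡) → lose a∈𝒜 y≡) (any? (λ a → y ≟G (x ⊕ a)) elems)

  Edge? : ∀ x y → Dec (Edge x y)
  Edge? x y = Adj? x y ⊎-dec Adj? y x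

  endpoints : ∀ u n → Enumeration (λ x → Walk u x n)
  endpoints u zero = record
    { list = u ∷ [] ; complete = λ { here → here refl } ; sound = λ { (here refl) → here } }
  endpoints u (suc n) = record
    { list     = concatMap next elems
    ; complete = λ { (step (a , a∈𝒜 , refl) rest) →
                     ∈-concatMap⁺ next (lose a∈𝒜 (complete (endpoints (u ⊕ a) n) rest)) }
    ; sound    = λ x∈ → let (a , a∈𝒜 , x∈next) = find (∈-concatMap⁻ next x∈)
                        in step (a , a∈𝒜 , refl) (sound (endpoints (u ⊕ a) n) x∈next)
    }
    where
    next : G k → List (G k)
    next a = list (endpoints (u ⊕ a) n)

  ball : ∀ r → Enumeration (λ x → ρ≤ x r)
  ball r = record
    { list     = concatMap level (upTo (suc r))
    ; complete = λ (n , n≤r , w) →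
                   ∈-concatMap⁺ level (lose (∈-upTo⁺ (s≤s n≤r)) (complete (endpoints 𝟎 n) w))
    ; sound    = λ x∈ → let (n , n∈ , x∈level) = find (∈-concatMap⁻ level x∈)
                        in n , s≤s⁻¹ (∈-upTo⁻ n∈) , sound (endpoints 𝟎 n) x∈level
    }
    where
    level : ℕ → List (G k)
    level n = list (endpoints 𝟎 n)

  ball-edges : ∀ r → Enumeration (λ p → E (B r) (proj₁ p) (proj₂ p))
  ball-edges r = enumerate-related-pairs (ball r) (ball r) Edge?

  module Isomorphism (r : ℕ) (λ′ : Subgraph) (φ : G k → G k) (iso : IsIso (B r) λ′ φ) where
    open IsIso iso

    c : G k
    c = φ 𝟎

    ψ : G k → G k
    ψ x = φ x ⊕ neg c

    ψ⊕c : ∀ x → ψ x ⊕ c ≡ φ x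
    ψ⊕c x = ⊕-cancel (⊕-inverseˡ c) (φ x)

    φ-edge : ∀ {x y} → E (B r) x y → Edge (φ x) (φ y)
    φ-edge e@(ρx , ρy , _) = proj₂ (proj₂ (E-ok λ′ (Equivalence.to (edges ρx ρy) e)))

    -- A walk of length m from u, where u is reached from 0 in j steps and j + m ≤ r,
    -- runs inside B_r; so φ carries it step by step to a walk of Γ.
    transport-walk : ∀ {u x j m} → Walk 𝟎 u j → Walk u x m → j + m ≤ r → Walk (φ u) (φ x) m
    transport-walk prefix here _ = here
    transport-walk {u} {j = j} {m = suc m} prefix (step {y = v} u~v rest) j+m≤r =
      step (Edge→Adj (φ-edge (ρu , ρv , inj₁ u~v))) (transport-walk (snoc prefix u~v) rest j+1+m≤r)
      where
      j+1+m≤r : suc j + m ≤ r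
      j+1+m≤r = subst (_≤ r) (+-suc j m) j+m≤r
      ρu : ρ≤ u r
      ρu = j , ≤-trans (m≤m+n j (suc m)) j+m≤r , prefix
      ρv : ρ≤ v r
      ρv = suc j , ≤-trans (m≤m+n (suc j) m) j+1+m≤r , snoc prefix u~v

    ψ-ball : ∀ {x} → ρ≤ x r → ρ≤ (ψ x) r
    ψ-ball {x} (n , n≤r , w) =
      n , n≤r , subst (λ s → Walk s (ψ x) n) (⊕-inverseʳ c) (Walk-translate (neg c) (transport-walk here w n≤r))

    ψ-injective : ∀ {x y} → ρ≤ x r → ρ≤ y r → ψ x ≡ ψ y → x ≡ y
    ψ-injective {x} {y} ρx ρy ψx≡ψy = injective ρx ρy (begin
      φ x      ≡⟨ sym (ψ⊕c x) ⟩
      ψ x ⊕ c  ≡⟨ cong (_⊕ c) ψx≡ψy ⟩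
      ψ y ⊕ c  ≡⟨ ψ⊕c y ⟩
      φ y      ∎)
      where open ≡-Reasoning

    ψ-surjective : ∀ {y} → ρ≤ y r → ∃ λ x → ρ≤ x r × ψ x ≡ y
    ψ-surjective = injective⇒surjective _≟G_ (ball r) ψ ψ-ball ψ-injective

    ψ² : G k × G k → G k × G k
    ψ² (x , y) = ψ x , ψ y

    ψ²-edge : ∀ {p} → E (B r) (proj₁ p) (proj₂ p) → E (B r) (proj₁ (ψ² p)) (proj₂ (ψ² p))
    ψ²-edge e@(ρx , ρy , _) = ψ-ball ρx , ψ-ball ρy , Edge-translate (neg c) (φ-edge e)

    ψ²-injective : ∀ {p q} → E (B r) (proj₁ p) (proj₂ p) → E (B r) (proj₁ q) (proj₂ q) → ψ² p ≡ ψ² q → p ≡ q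
    ψ²-injective (ρx , ρy , _) (ρx′ , ρy′ , _) e =
      cong₂ _,_ (ψ-injective ρx ρx′ (cong proj₁ e)) (ψ-injective ρy ρy′ (cong proj₂ e))

    ψ²-surjective : ∀ {q} → E (B r) (proj₁ q) (proj₂ q) → ∃ λ p → E (B r) (proj₁ p) (proj₂ p) × ψ² p ≡ q
    ψ²-surjective = injective⇒surjective (≡-dec _≟G_ _≟G_) (ball-edges r) ψ² ψ²-edge ψ²-injective

    vertex-to : ∀ {y} → V λ′ y → TransV (B r) c y
    vertex-to vy with x , ρx , refl ← surjective vy = ψ x , ψ-ball ρx , sym (ψ⊕c x)

    vertex-from : ∀ {y} → TransV (B r) c y → V λ′ y
    vertex-from (z , ρz , refl) with x , ρx , refl ← ψ-surjective ρz =
      subst (V λ′) (sym (ψ⊕c x)) (maps-to ρx)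

    edge-to : ∀ {y y′} → E λ′ y y′ → TransE (B r) c y y′
    edge-to e with vy , vy′ , Γ-edge ← E-ok λ′ e
              with z , ρz , refl ← vertex-to vy | z′ , ρz′ , refl ← vertex-to vy′ =
      z , z′ , (ρz , ρz′ , Edge-untranslate c Γ-edge) , refl , refl

    edge-from : ∀ {y y′} → TransE (B r) c y y′ → E λ′ y y′
    edge-from (z , z′ , e , refl , refl) with (x , x′) , e′@(ρx , ρx′ , _) , refl ← ψ²-surjective e =
      subst₂ (E λ′) (sym (ψ⊕c x)) (sym (ψ⊕c x′)) (Equivalence.to (edges ρx ρx′) e′)

proposition3 : (k : ℕ) → k ≥ 1 → (𝒜 : GenSet k) → let open Cayley 𝒜 in
    (r : ℕ) (λ′ : Subgraph) (φ : G k → G k) → IsIso (B r) λ′ φ →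
    λ′ ≐ B r + φ 𝟎
proposition3 k _ 𝒜 r λ′ φ iso =
  (λ _ → mk⇔ vertex-to vertex-from) , (λ _ _ → mk⇔ edge-to edge-from)
  where open CayleyFacts.Isomorphism 𝒜 r λ′ φ iso
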